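{- Let $T$ be a symmetric tree and let $F_T$ be a functigraph of $T$ (for some function $g$) that is symmetric. Then $fix(F_T)=2|T|-t$ for some $t$ with $2\leq t\leq 3$ if and only if $T=P_2$.
   Context: $|T|$ denotes the order of $T$. A set $S\subseteq V(H)$ is a fixing set of a graph $H$ if the only automorphism of $H$ fixing every vertex of $S$ is the identity; $fix(H)$ is the minimum cardinality of a fixing set of $H$. A graph $H$ is symmetric if $fix(H)\neq 0$. Functigraph: for disjoint copies $T_1,T_2$ of $T$, $A=V(T_1)$, $B=V(T_2)$ and a function $g:A\to B$, $F_T$ is the graph with vertex set $A\cup B$ and edge set $E(T_1)\cup E(T_2)\cup\{uv:u\in A,\ v=g(u)\}$. -}

module Defs where

open import Data.Nat using (ℕ; zero; suc; _+_; _≤_; _<_)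
open import Data.Fin using (Fin; toℕ; splitAt; _≟_)
open import Data.Fin.Subset using (Subset; _∈_; ∣_∣)
open import Data.Fin.Permutation using (Permutation′; _⟨$⟩ʳ_)
open import Data.Bool using (Bool; true; false)
open import Data.Sum using (_⊎_; inj₁; inj₂)
open import Data.Product using (Σ; _×_; _,_; ∃-syntax)
open import Data.List using (List; []; _∷_; length; last)
open import Data.List.Relation.Unary.Unique.Propositional using (Unique)
open import Data.Maybe using (just)
open import Function.Bundles using (_↔_; Inverse)
open import Relation.Nullary using (¬_; does)
open import Relation.Binary.PropositionalEquality using (_≡_)

Graph : ℕ → Set
Graph n = Fin n → Fin n → Bool

IsSimple : ∀ {n} → Graph n → Set
IsSimple {n} G = (∀ u v → G u v ≡ G v u) × (∀ u → G u u ≡ false)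

IsWalk : ∀ {n} → Graph n → List (Fin n) → Set
IsWalk G [] = Data.Unit.⊤ where import Data.Unit
IsWalk G (x ∷ []) = Data.Unit.⊤ where import Data.Unit
IsWalk G (x ∷ y ∷ xs) = (G x y ≡ true) × IsWalk G (y ∷ xs)

WalkFromTo : ∀ {n} → Graph n → Fin n → Fin n → List (Fin n) → Set
WalkFromTo G u v [] = Data.Empty.⊥ where import Data.Empty
WalkFromTo G u v (x ∷ xs) = (x ≡ u) × (last (x ∷ xs) ≡ just v) × IsWalk G (x ∷ xs)

IsConnected : ∀ {n} → Graph n → Set
IsConnected {n} G = ∀ (u v : Fin n) → ∃[ w ] WalkFromTo G u v w

IsCycle : ∀ {n} → Graph n → List (Fin n) → Set
IsCycle G [] = Data.Empty.⊥ where import Data.Empty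
IsCycle G (x ∷ xs) =
  (3 ≤ length (x ∷ xs)) × Unique (x ∷ xs) × IsWalk G (x ∷ xs)
  × (∃[ y ] ((last (x ∷ xs) ≡ just y) × (G y x ≡ true)))

IsAcyclic : ∀ {n} → Graph n → Set
IsAcyclic {n} G = ∀ (c : List (Fin n)) → ¬ IsCycle G c

IsTree : ∀ {n} → Graph n → Set
IsTree {n} G = (1 ≤ n) × IsSimple G × IsConnected G × IsAcyclic G

record Automorphism {n} (G : Graph n) : Set where
  field
    perm     : Permutation′ n
    preserve : ∀ u v → G (perm ⟨$⟩ʳ u) (perm ⟨$⟩ʳ v) ≡ G u v

open Automorphism public

IsFixingSet : ∀ {n} → Graph n → Subset n → Set
IsFixingSet {n} G S =
  ∀ (σ : Automorphism G) → (∀ v → v ∈ S → perm σ ⟨$⟩ʳ v ≡ v) →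
  ∀ v → perm σ ⟨$⟩ʳ v ≡ v

IsFixNumber : ∀ {n} → Graph n → ℕ → Set
IsFixNumber {n} G k =
  (∃[ S ] (IsFixingSet G S × ∣ S ∣ ≡ k)) × (∀ S → IsFixingSet G S → k ≤ ∣ S ∣)

IsSymmetric : ∀ {n} → Graph n → Set
IsSymmetric G = ¬ IsFixNumber G 0

-- functigraph: vertices Fin (n + n); first copy A = left part, second copy B = right
-- part; u ∈ A is joined to g(u) ∈ B.
functigraph : ∀ {n} → Graph n → (Fin n → Fin n) → Graph (n + n)
functigraph {n} T g x y with splitAt n x | splitAt n y
... | inj₁ u | inj₁ v = T u v
... | inj₂ u | inj₂ v = T u v
... | inj₁ u | inj₂ v = does (g u ≟ v)
... | inj₂ u | inj₁ v = does (g v ≟ u)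

pathGraph : (m : ℕ) → Graph m
pathGraph m i j = does (suc (toℕ i) Data.Nat.≟ toℕ j) Data.Bool.∨ does (suc (toℕ j) Data.Nat.≟ toℕ i)
  where import Data.Nat; import Data.Bool

IsIsomorphic : ∀ {n m} → Graph n → Graph m → Set
IsIsomorphic {n} {m} G H =
  Σ (Fin n ↔ Fin m) λ φ → ∀ u v → H (Inverse.to φ u) (Inverse.to φ v) ≡ G u v

module Submission where

-- The basic tool (module Anchored) turns a "rigid local configuration" into a small fixing
-- set: if some vertices e i, together with anchor vertices k f, induce a configuration
-- whose only adjacency-preserving relabelling is the identity, then all vertices except
-- the e i form a fixing set.  Rigidity of a concrete configuration is decidable.
-- * |T| = 1 is impossible (such a T is not symmetric).
-- * |T| ≥ 3: T is not P₂ and contains an induced path v - u - w.  The six copies of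
--   v, u, w in F induce a graph determined by where g sends v, u, w; for each of the 4³
--   possibilities a computation shows that one of two choices of four of these six
--   vertices is rigid.  Hence fix(F) ≤ 2|T| - 4 and no t ≤ 3 works.
-- * |T| = 2: T = P₂ and F is one of four graphs on four vertices, with fix(F) = 1 = 4 - 3
--   when g is constant (lower bound: F is symmetric) and fix(F) = 2 = 4 - 2 otherwise.

open import Defs
open import Data.Nat using (ℕ; zero; suc; _+_; _*_; _∸_; _≤_; z≤n; s≤s)
open import Data.Nat.Properties
  using (≤-refl; ≤-trans; ≤-reflexive; ≤-antisym; +-comm; +-suc; +-monoʳ-≤; +-identityʳ; m+n≤o⇒m≤o∸n;
         ∸-monoˡ-≤; ∸-monoʳ-≤; n≮n)
open import Data.Fin using (Fin; zero; suc; _≟_; splitAt; join; inject₁; fromℕ; #_)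
open import Data.Fin.Properties
  using (all?; any?; splitAt-join; splitAt-↑ˡ; splitAt-↑ʳ; inject₁-injective; fromℕ≢inject₁; 0≢1+n; suc-injective)
open import Data.Fin.Subset using (Subset; _∈_; ∣_∣; ⊤; _-_) renaming (⊥ to ∅)
open import Data.Fin.Subset.Properties
  using (∈⊤; ∣⊤∣≡n; ∣⊥∣≡0; x∈p∧x≢y⇒x∈p-y; x∈p⇒∣p-x∣<∣p∣; nonempty?; _∈?_)
open import Data.Fin.Permutation using (_⟨$⟩ʳ_; _⟨$⟩ˡ_; inverseˡ; transpose; ↔⇒≡)
import Data.Fin.Permutation as Permutation
open import Data.Vec using (Vec; []; _∷_; lookup; tabulate)
open import Data.Vec.Properties using (lookup∘tabulate)
open import Data.List using ([]; _∷_; last)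
import Data.List.Relation.Unary.All as All
import Data.List.Relation.Unary.AllPairs as AP
open import Data.Maybe using (just)
open import Data.Maybe.Properties using (just-injective)
open import Data.Bool using (Bool; true; false)
import Data.Bool.Properties as Bool
open import Data.Sum using (_⊎_; inj₁; inj₂)
import Data.Sum as Sum
import Data.Sum.Properties as Sum
open import Data.Product using (Σ; _×_; _,_; proj₁; proj₂; ∃-syntax)
open import Data.Empty using (⊥; ⊥-elim)
open import Function using (_∘_)
open import Function.Bundles using (_⇔_; mk⇔)
open import Relation.Nullary using (Dec; yes; no; does; ¬_)
open import Relation.Nullary.Decidable
  using (map′; _→-dec_; _×-dec_; _⊎-dec_; ¬?; True; toWitness; does-⇔; decidable-stable)
open import Relation.Unary using (Decidable)
open import Relation.Binary.Definitions using (DecidableEquality)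
open import Relation.Binary.PropositionalEquality using (_≡_; _≢_; refl; sym; trans; cong; cong₂; subst)

-- Injectivity with explicit arguments, so that it can be decided on finite domains.
IsInjective : {A B : Set} → (A → B) → Set
IsInjective f = ∀ x y → f x ≡ f y → x ≡ y

injective? : ∀ {m} {B : Set} → DecidableEquality B → (f : Fin m → B) → Dec (IsInjective f)
injective? _≟B_ f = all? λ x → all? λ y → (f x ≟B f y) →-dec (x ≟ y)

-- A property of all tables (vectors) over a finite set is decidable; this is how we
-- quantify over all self-maps of a small Fin.
∀-table? : ∀ {m} k {P : Vec (Fin m) k → Set} → (∀ v → Dec (P v)) → Dec (∀ v → P v)
∀-table? zero    P? = map′ (λ { p [] → p }) (λ h → h []) (P? [])
∀-table? (suc k) P? = map′ (λ { h (x ∷ v) → h x v }) (λ h x v → h (x ∷ v))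
  (all? λ x → ∀-table? k λ v → P? (x ∷ v))

-- A local configuration consists of r free vertices with adjacency L among themselves
-- and adjacency K towards s anchor vertices.
Respects : ∀ {r s} → (Fin r → Fin r → Bool) → (Fin r → Fin s → Bool) → (Fin r → Fin r) → Set
Respects L K π = IsInjective π × (∀ i j → L (π i) (π j) ≡ L i j) × (∀ i f → K (π i) f ≡ K i f)

Rigid : ∀ {r s} → (Fin r → Fin r → Bool) → (Fin r → Fin s → Bool) → Set
Rigid {r} L K = (π : Fin r → Fin r) → Respects L K π → ∀ i → π i ≡ i

respects-cong : ∀ {r s} {L : Fin r → Fin r → Bool} {K : Fin r → Fin s → Bool} {π ρ : Fin r → Fin r} →
  (∀ i → π i ≡ ρ i) → Respects L K π → Respects L K ρ
respects-cong {L = L} {K} {π} {ρ} π≗ρ (π-inj , πL , πK) = ρ-inj , ρL , ρK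
  where
  ρ-inj : IsInjective ρ
  ρ-inj x y eq = π-inj x y (trans (π≗ρ x) (trans eq (sym (π≗ρ y))))
  ρL : ∀ i j → L (ρ i) (ρ j) ≡ L i j
  ρL i j = trans (sym (cong₂ L (π≗ρ i) (π≗ρ j))) (πL i j)
  ρK : ∀ i f → K (ρ i) f ≡ K i f
  ρK i f = trans (sym (cong (λ z → K z f) (π≗ρ i))) (πK i f)

respects? : ∀ {r s} (L : Fin r → Fin r → Bool) (K : Fin r → Fin s → Bool) π → Dec (Respects L K π)
respects? L K π = injective? _≟_ π
  ×-dec (all? λ i → all? λ j → L (π i) (π j) Bool.≟ L i j)
  ×-dec (all? λ i → all? λ f → K (π i) f Bool.≟ K i f)

-- Rigidity is decidable: it suffices to test the relabellings given by tables.
rigid? : ∀ {r s} (L : Fin r → Fin r → Bool) (K : Fin r → Fin s → Bool) → Dec (Rigid L K)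
rigid? {r} L K = map′ fromTables (λ h p → h (lookup p))
  (∀-table? r λ p → respects? L K (lookup p) →-dec all? λ i → lookup p i ≟ i)
  where
  fromTables : (∀ p → Respects L K (lookup p) → ∀ i → lookup p i ≡ i) → Rigid L K
  fromTables h π resp i = trans (sym (lookup∘tabulate π i))
    (h (tabulate π) (respects-cong (λ j → sym (lookup∘tabulate π j)) resp) i)

automorphism-injective : ∀ {N} {G : Graph N} (σ : Automorphism G) → IsInjective (perm σ ⟨$⟩ʳ_)
automorphism-injective σ x y eq =
  trans (sym (inverseˡ (perm σ))) (trans (cong (perm σ ⟨$⟩ˡ_) eq) (inverseˡ (perm σ)))

without : ∀ {N r} → (Fin r → Fin N) → Subset N
without {r = zero}  f = ⊤
without {r = suc r} f = without (f ∘ suc) - f zero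

∉image⇒∈without : ∀ {N r} (f : Fin r → Fin N) z → (∀ i → z ≢ f i) → z ∈ without f
∉image⇒∈without {r = zero}  f z z∉f = ∈⊤
∉image⇒∈without {r = suc r} f z z∉f =
  x∈p∧x≢y⇒x∈p-y (∉image⇒∈without (f ∘ suc) z (z∉f ∘ suc)) (z∉f zero)

without-size : ∀ {N r} (f : Fin r → Fin N) → IsInjective f → r + ∣ without f ∣ ≤ N
without-size {N} {zero}  f f-inj = ≤-reflexive (∣⊤∣≡n N)
without-size {N} {suc r} f f-inj =
  ≤-trans shrink (without-size (f ∘ suc) λ x y eq → suc-injective (f-inj (suc x) (suc y) eq))
  where
  f0∈rest : f zero ∈ without (f ∘ suc)
  f0∈rest = ∉image⇒∈without (f ∘ suc) (f zero) λ i eq → 0≢1+n (f-inj zero (suc i) eq)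
  shrink : suc r + ∣ without f ∣ ≤ r + ∣ without (f ∘ suc) ∣
  shrink = ≤-trans (≤-reflexive (sym (+-suc r _))) (+-monoʳ-≤ r (x∈p⇒∣p-x∣<∣p∣ f0∈rest))

-- Let the vertices e i (pairwise distinct) and the anchors k f (none of them
-- an e i) of G induce a rigid configuration.  Then an automorphism fixing every vertex
-- other than the e i permutes the e i and respects the configuration, so it is the
-- identity: all vertices except the e i form a fixing set.
module Anchored {N r s} (G : Graph N) (e : Fin r → Fin N) (k : Fin s → Fin N)
  (e-inj : IsInjective e) (k∉e : ∀ f i → k f ≢ e i)
  (L : Fin r → Fin r → Bool) (K : Fin r → Fin s → Bool)
  (G≡L : ∀ i j → G (e i) (e j) ≡ L i j) (G≡K : ∀ i f → G (e i) (k f) ≡ K i f)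
  (rigid : Rigid L K) where

  fixingSet : IsFixingSet G (without e)
  fixingSet σ fixes = fixesAll
    where
    σ′ : Fin N → Fin N
    σ′ = perm σ ⟨$⟩ʳ_

    fixesOutside : ∀ z → (∀ i → z ≢ e i) → σ′ z ≡ z
    fixesOutside z z∉e = fixes z (∉image⇒∈without e z z∉e)

    -- σ maps each e i to some e j: otherwise σ (e i) would be fixed, forcing e i = σ (e i).
    stays : ∀ i → ∃[ j ] (σ′ (e i) ≡ e j)
    stays i with any? (λ j → σ′ (e i) ≟ e j)
    ... | yes found = found
    ... | no notFound = ⊥-elim (notFound (i , automorphism-injective σ _ _ image-fixed))
      where
      image-fixed : σ′ (σ′ (e i)) ≡ σ′ (e i)
      image-fixed = fixesOutside (σ′ (e i)) λ j eq → notFound (j , eq)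

    π : Fin r → Fin r
    π i = proj₁ (stays i)

    eπ : ∀ i → e (π i) ≡ σ′ (e i)
    eπ i = sym (proj₂ (stays i))

    respects : Respects L K π
    respects = π-inj , πL , πK
      where
      π-inj : IsInjective π
      π-inj x y eq = e-inj x y
        (automorphism-injective σ (e x) (e y) (trans (sym (eπ x)) (trans (cong e eq) (eπ y))))
      πL : ∀ i j → L (π i) (π j) ≡ L i j
      πL i j = trans (sym (G≡L (π i) (π j)))
        (trans (cong₂ G (eπ i) (eπ j)) (trans (preserve σ (e i) (e j)) (G≡L i j)))
      πK : ∀ i f → K (π i) f ≡ K i f
      πK i f = trans (sym (G≡K (π i) f))
        (trans (cong₂ G (eπ i) (sym (fixesOutside (k f) (k∉e f))))
        (trans (preserve σ (e i) (k f)) (G≡K i f)))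

    fixesAll : ∀ z → σ′ z ≡ z
    fixesAll z with any? (λ i → z ≟ e i)
    ... | yes (i , refl) = trans (sym (eπ i)) (cong e (rigid π respects i))
    ... | no z∉e = fixesOutside z λ i eq → z∉e (i , eq)

  smallFixingSet : ∃[ S ] (IsFixingSet G S × r + ∣ S ∣ ≤ N)
  smallFixingSet = without e , fixingSet , without-size e e-inj

module _ {N} {G H : Graph N} (G≗H : ∀ x y → G x y ≡ H x y) where

  automorphism-transfer : Automorphism H → Automorphism G
  automorphism-transfer σ = record
    { perm = perm σ
    ; preserve = λ u v → trans (G≗H _ _) (trans (preserve σ u v) (sym (G≗H u v))) }

  fixingSet-transfer : ∀ {S} → IsFixingSet G S → IsFixingSet H S
  fixingSet-transfer fixing σ = fixing (automorphism-transfer σ)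

fixNumber-transfer : ∀ {N} {G H : Graph N} → (∀ x y → G x y ≡ H x y) → ∀ {k} → IsFixNumber G k → IsFixNumber H k
fixNumber-transfer G≗H ((S , fixing , size) , minimal) =
  (S , fixingSet-transfer G≗H fixing , size) ,
  λ S′ fixing′ → minimal S′ (fixingSet-transfer (λ x y → sym (G≗H x y)) fixing′)

symmetric-transfer : ∀ {N} {G H : Graph N} → (∀ x y → G x y ≡ H x y) → IsSymmetric G → IsSymmetric H
symmetric-transfer G≗H symG fix0 = symG (fixNumber-transfer (λ x y → sym (G≗H x y)) fix0)

fixNumber-intro : ∀ {N r} {G : Graph N} → ∃[ S ] (IsFixingSet G S × r + ∣ S ∣ ≤ N) →
  (∀ S → IsFixingSet G S → N ∸ r ≤ ∣ S ∣) → IsFixNumber G (N ∸ r)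
fixNumber-intro {N} {r} (S , fixing , size) minimal =
  (S , fixing , ≤-antisym (m+n≤o⇒m≤o∸n ∣ S ∣ (subst (_≤ N) (+-comm r ∣ S ∣) size)) (minimal S fixing)) ,
  minimal

symmetric⇒fixingSet-nonempty : ∀ {N} {G : Graph N} → IsSymmetric G → ∀ S → IsFixingSet G S → 1 ≤ ∣ S ∣
symmetric⇒fixingSet-nonempty symG S fixing with ∣ S ∣ in size
... | zero  = ⊥-elim (symG ((S , fixing , size) , λ _ _ → z≤n))
... | suc _ = s≤s z≤n

singleVertex-asymmetric : (G : Graph 1) → ¬ IsSymmetric G
singleVertex-asymmetric G symG = symG ((∅ , fixing , ∣⊥∣≡0 1) , λ _ _ → z≤n)
  where
  fixing : IsFixingSet G ∅
  fixing σ _ zero with perm σ ⟨$⟩ʳ zero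
  ... | zero = refl

FixedNontrivially : ∀ {N} → Graph N → Fin N → Set
FixedNontrivially G x = Σ (Automorphism G) λ σ → (perm σ ⟨$⟩ʳ x ≡ x) × ∃[ y ] (perm σ ⟨$⟩ʳ y ≢ y)

fixingSet-two : ∀ {N} (G : Graph (suc N)) → (∀ x → FixedNontrivially G x) →
  ∀ S → IsFixingSet G S → 2 ≤ ∣ S ∣
fixingSet-two G nontrivial S fixing with nonempty? S
... | no empty with nontrivial zero
...   | σ , _ , y , moved = ⊥-elim (moved (fixing σ (λ v v∈S → ⊥-elim (empty (v , v∈S))) y))
fixingSet-two G nontrivial S fixing | yes (x , x∈S) with any? (λ y → (y ∈? S) ×-dec ¬? (y ≟ x))
... | yes (y , y∈S , y≢x) =
  ≤-trans (s≤s (≤-trans (s≤s z≤n) (x∈p⇒∣p-x∣<∣p∣ (x∈p∧x≢y⇒x∈p-y y∈S y≢x)))) (x∈p⇒∣p-x∣<∣p∣ x∈S)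
... | no onlyX with nontrivial x
...   | σ , σx≡x , y , moved = ⊥-elim (moved (fixing σ fixesS y))
  where
  fixesS : ∀ v → v ∈ S → perm σ ⟨$⟩ʳ v ≡ v
  fixesS v v∈S with decidable-stable (v ≟ x) (λ v≢x → onlyX (v , v∈S , v≢x))
  ... | refl = σx≡x

-- Being fixed by a transposition that is an automorphism is a decidable witness of
-- FixedNontrivially.
IsAutomorphismMap : ∀ {N} → Graph N → (Fin N → Fin N) → Set
IsAutomorphismMap G π = ∀ u v → G (π u) (π v) ≡ G u v

FixedByTransposition : ∀ {N} → Graph N → Fin N → Set
FixedByTransposition G x = ∃[ i ] ∃[ j ] let τ = transpose i j ⟨$⟩ʳ_ in
  IsAutomorphismMap G τ × τ x ≡ x × ∃[ y ] (τ y ≢ y)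

fixedByTransposition? : ∀ {N} (G : Graph N) x → Dec (FixedByTransposition G x)
fixedByTransposition? G x = any? λ i → any? λ j → let τ = transpose i j ⟨$⟩ʳ_ in
  (all? λ u → all? λ v → G (τ u) (τ v) Bool.≟ G u v)
  ×-dec (τ x ≟ x) ×-dec any? λ y → ¬? (τ y ≟ y)

fixedByTransposition⇒nontrivially : ∀ {N} (G : Graph N) x → FixedByTransposition G x → FixedNontrivially G x
fixedByTransposition⇒nontrivially G x (i , j , aut , fixed , moved) =
  record { perm = transpose i j ; preserve = aut } , fixed , moved

InducedCopy : ∀ {k n} → Graph k → Graph n → Set
InducedCopy {k} {n} H G = Σ (Fin k → Fin n) λ φ → IsInjective φ × (∀ i j → G (φ i) (φ j) ≡ H i j)

module Walks {n} (T : Graph n) (irreflexive : ∀ a → T a a ≡ false) where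

  adjacent⇒distinct : ∀ {a b} → T a b ≡ true → a ≢ b
  adjacent⇒distinct {a} Tab refl with trans (sym Tab) (irreflexive a)
  ... | ()

  neighbour : ∀ {x y} → x ≢ y → ∀ ws → WalkFromTo T x y ws → ∃[ z ] (T x z ≡ true)
  neighbour x≢y (a ∷ [])    (refl , end , _)     = ⊥-elim (x≢y (just-injective end))
  neighbour x≢y (a ∷ b ∷ _) (refl , _ , Tab , _) = b , Tab

  exitEdge : {P : Fin n → Set} → Decidable P → ∀ {t} → P t → ∀ a as → ¬ P a →
    last (a ∷ as) ≡ just t → IsWalk T (a ∷ as) → ∃[ p ] ∃[ q ] (¬ P p × P q × T p q ≡ true)
  exitEdge P? Pt a []       ¬Pa end _ with just-injective end
  ... | refl = ⊥-elim (¬Pa Pt)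
  exitEdge P? Pt a (b ∷ bs) ¬Pa end (Tab , walk) with P? b
  ... | yes Pb = a , b , ¬Pa , Pb , Tab
  ... | no ¬Pb = exitEdge P? Pt b bs ¬Pb end walk

module TreeFacts {n} (T : Graph n) (tree : IsTree T) where

  private
    symmetric : ∀ a b → T a b ≡ T b a
    symmetric = proj₁ (proj₁ (proj₂ tree))
    irreflexive : ∀ a → T a a ≡ false
    irreflexive = proj₂ (proj₁ (proj₂ tree))
    connected : IsConnected T
    connected = proj₁ (proj₂ (proj₂ tree))
    acyclic : IsAcyclic T
    acyclic = proj₂ (proj₂ (proj₂ tree))

  open Walks T irreflexive

  neighbourOf : ∀ {x y} → x ≢ y → ∃[ z ] (T x z ≡ true)
  neighbourOf {x} {y} x≢y = neighbour x≢y (proj₁ (connected x y)) (proj₂ (connected x y))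

  noTriangle : ∀ {v u w} → v ≢ w → T v u ≡ true → T u w ≡ true → T v w ≡ false
  noTriangle {v} {u} {w} v≢w Tvu Tuw with T v w in Tvw
  ... | false = refl
  ... | true = ⊥-elim (acyclic (v ∷ u ∷ w ∷ [])
    ( s≤s (s≤s (s≤s z≤n))
    , ((adjacent⇒distinct Tvu All.∷ v≢w All.∷ All.[]) AP.∷ (adjacent⇒distinct Tuw All.∷ All.[]) AP.∷ All.[] AP.∷ AP.[])
    , (Tvu , Tuw , _)
    , (w , refl , trans (symmetric w v) Tvw)))

  inducedPath : ∀ {v u w} → v ≢ w → T v u ≡ true → T u w ≡ true → InducedCopy (pathGraph 3) T
  inducedPath {v} {u} {w} v≢w Tvu Tuw = φ , φ-inj , φ-adj
    where
    v≢u : v ≢ u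
    v≢u = adjacent⇒distinct Tvu
    u≢w : u ≢ w
    u≢w = adjacent⇒distinct Tuw
    Tvw : T v w ≡ false
    Tvw = noTriangle v≢w Tvu Tuw
    φ : Fin 3 → Fin n
    φ = lookup (v ∷ u ∷ w ∷ [])
    φ-inj : IsInjective φ
    φ-inj zero zero _ = refl
    φ-inj zero (suc zero) eq = ⊥-elim (v≢u eq)
    φ-inj zero (suc (suc zero)) eq = ⊥-elim (v≢w eq)
    φ-inj (suc zero) zero eq = ⊥-elim (v≢u (sym eq))
    φ-inj (suc zero) (suc zero) _ = refl
    φ-inj (suc zero) (suc (suc zero)) eq = ⊥-elim (u≢w eq)
    φ-inj (suc (suc zero)) zero eq = ⊥-elim (v≢w (sym eq))
    φ-inj (suc (suc zero)) (suc zero) eq = ⊥-elim (u≢w (sym eq))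
    φ-inj (suc (suc zero)) (suc (suc zero)) _ = refl
    φ-adj : ∀ i j → T (φ i) (φ j) ≡ pathGraph 3 i j
    φ-adj zero zero = irreflexive v
    φ-adj zero (suc zero) = Tvu
    φ-adj zero (suc (suc zero)) = Tvw
    φ-adj (suc zero) zero = trans (symmetric u v) Tvu
    φ-adj (suc zero) (suc zero) = irreflexive u
    φ-adj (suc zero) (suc (suc zero)) = Tuw
    φ-adj (suc (suc zero)) zero = trans (symmetric w v) Tvw
    φ-adj (suc (suc zero)) (suc zero) = trans (symmetric w u) Tuw
    φ-adj (suc (suc zero)) (suc (suc zero)) = irreflexive w

  -- A tree with three distinct vertices contains an induced P₃: take a neighbour a of x₀
  -- and a vertex z outside {x₀, a}; the walk from z to x₀ enters {x₀, a} along an edge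
  -- p q, giving the path x₀ - a - p or a - x₀ - p.
  inducedP₃ : ∀ {x₀ x₁ x₂} → x₀ ≢ x₁ → x₀ ≢ x₂ → x₁ ≢ x₂ → InducedCopy (pathGraph 3) T
  inducedP₃ {x₀} {x₁} {x₂} x₀≢x₁ x₀≢x₂ x₁≢x₂ = pathFromEdge enteringEdge
    where
    a : Fin n
    a = proj₁ (neighbourOf x₀≢x₁)
    Tx₀a : T x₀ a ≡ true
    Tx₀a = proj₂ (neighbourOf x₀≢x₁)
    P : Fin n → Set
    P y = y ≡ x₀ ⊎ y ≡ a
    P? : Decidable P
    P? y = (y ≟ x₀) ⊎-dec (y ≟ a)
    outside : ∃[ z ] ¬ P z
    outside with a ≟ x₁
    ... | yes a≡x₁ = x₂ , Sum.[ (λ eq → x₀≢x₂ (sym eq)) , (λ eq → x₁≢x₂ (trans (sym a≡x₁) (sym eq))) ]′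
    ... | no a≢x₁  = x₁ , Sum.[ (λ eq → x₀≢x₁ (sym eq)) , (λ eq → a≢x₁ (sym eq)) ]′
    enteringEdge : ∃[ p ] ∃[ q ] (¬ P p × P q × T p q ≡ true)
    enteringEdge with connected (proj₁ outside) x₀
    ... | b ∷ bs , refl , end , walk = exitEdge P? (inj₁ refl) b bs (proj₂ outside) end walk
    pathFromEdge : ∃[ p ] ∃[ q ] (¬ P p × P q × T p q ≡ true) → InducedCopy (pathGraph 3) T
    pathFromEdge (p , _ , ¬Pp , inj₂ refl , Tap) =
      inducedPath (λ eq → ¬Pp (inj₁ (sym eq))) Tx₀a (trans (symmetric a p) Tap)
    pathFromEdge (p , _ , ¬Pp , inj₁ refl , Tx₀p) =
      inducedPath (λ eq → ¬Pp (inj₂ (sym eq))) (trans (symmetric a x₀) Tx₀a) (trans (symmetric x₀ p) Tx₀p)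

twoVertexTree-isPath : (T : Graph 2) → IsTree T → ∀ u v → T u v ≡ pathGraph 2 u v
twoVertexTree-isPath T tree@(_ , (symmetric , irreflexive) , _ , _) = adjacency
  where
  open TreeFacts T tree using (neighbourOf)
  open Walks T irreflexive using (adjacent⇒distinct)
  T01 : T zero (suc zero) ≡ true
  T01 with neighbourOf {zero} {suc zero} (λ ())
  ... | zero , T00 = ⊥-elim (adjacent⇒distinct T00 refl)
  ... | suc zero , T01 = T01
  adjacency : ∀ u v → T u v ≡ pathGraph 2 u v
  adjacency zero zero = irreflexive zero
  adjacency zero (suc zero) = T01
  adjacency (suc zero) zero = trans (symmetric (suc zero) zero) T01
  adjacency (suc zero) (suc zero) = irreflexive (suc zero)

functigraph-cong : ∀ {n} {T T′ : Graph n} {g g′ : Fin n → Fin n} →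
  (∀ u v → T u v ≡ T′ u v) → (∀ u → g u ≡ g′ u) → ∀ x y → functigraph T g x y ≡ functigraph T′ g′ x y
functigraph-cong {n} T≗T′ g≗g′ x y with splitAt n x | splitAt n y
... | inj₁ u | inj₁ v = T≗T′ u v
... | inj₂ u | inj₂ v = T≗T′ u v
... | inj₁ u | inj₂ v = cong (λ z → does (z ≟ v)) (g≗g′ u)
... | inj₂ u | inj₁ v = cong (λ z → does (z ≟ u)) (g≗g′ v)

-- The position of a vertex on an injective list φ of vertices, or fromℕ k when the
-- vertex does not occur on it.
module Positions {k n} (φ : Fin k → Fin n) (φ-inj : IsInjective φ) where

  position : Fin n → Fin (suc k)
  position z with any? (λ i → φ i ≟ z)
  ... | yes (i , _) = inject₁ i
  ... | no _        = fromℕ k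

  position-spec : ∀ z j → (z ≡ φ j) ⇔ (position z ≡ inject₁ j)
  position-spec z j with any? (λ i → φ i ≟ z)
  ... | yes (i , φi≡z) = mk⇔ (λ z≡φj → cong inject₁ (φ-inj i j (trans φi≡z z≡φj)))
                             (λ i≡j → trans (sym φi≡z) (cong φ (inject₁-injective i≡j)))
  ... | no none        = mk⇔ (λ z≡φj → ⊥-elim (none (j , sym z≡φj)))
                             (λ absurd → ⊥-elim (fromℕ≢inject₁ absurd))

-- Vertices of the local configuration: the positions 0, 1, 2 of a path, taken in the
-- first (inj₁) or in the second (inj₂) copy.
Position : Set
Position = Fin 3 ⊎ Fin 3

-- The graph induced in a functigraph by both copies of an induced path 0 - 1 - 2, where
-- code i = inject₁ j records that g sends position i to position j, and code i = fromℕ 3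
-- that g sends it off the path.
localGraph : (Fin 3 → Fin 4) → Position → Position → Bool
localGraph code (inj₁ i) (inj₁ j) = pathGraph 3 i j
localGraph code (inj₂ i) (inj₂ j) = pathGraph 3 i j
localGraph code (inj₁ i) (inj₂ j) = does (code i ≟ inject₁ j)
localGraph code (inj₂ i) (inj₁ j) = does (code j ≟ inject₁ i)

record Choice : Set where
  field
    free   : Vec Position 4
    anchor : Vec Position 2
open Choice

WellFormed : Choice → Set
WellFormed ch = IsInjective (lookup (free ch)) × (∀ f i → lookup (anchor ch) f ≢ lookup (free ch) i)

RigidChoice : (Fin 3 → Fin 4) → Choice → Set
RigidChoice code ch = Rigid (λ i j → localGraph code (lookup (free ch) i) (lookup (free ch) j))
                            (λ i f → localGraph code (lookup (free ch) i) (lookup (anchor ch) f))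

choice₁ : Choice
choice₁ = record { free   = inj₁ (# 0) ∷ inj₁ (# 1) ∷ inj₂ (# 0) ∷ inj₂ (# 1) ∷ []
                 ; anchor = inj₁ (# 2) ∷ inj₂ (# 2) ∷ [] }

choice₂ : Choice
choice₂ = record { free   = inj₁ (# 0) ∷ inj₁ (# 1) ∷ inj₂ (# 1) ∷ inj₂ (# 2) ∷ []
                 ; anchor = inj₁ (# 2) ∷ inj₂ (# 0) ∷ [] }

wellFormed? : ∀ ch → Dec (WellFormed ch)
wellFormed? ch = injective? (Sum.≡-dec _≟_ _≟_) (lookup (free ch))
  ×-dec (all? λ f → all? λ i → ¬? (Sum.≡-dec _≟_ _≟_ (lookup (anchor ch) f) (lookup (free ch) i)))

choices-wellFormed : WellFormed choice₁ × WellFormed choice₂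
choices-wellFormed = toWitness {a? = wellFormed? choice₁ ×-dec wellFormed? choice₂} _

-- The finite heart of the argument, checked by computation: whatever g does on the path,
-- one of the two choices gives a rigid configuration.  The check is split according to
-- the first entry of the code, which keeps each computation small.
GoodCode : Vec (Fin 4) 3 → Set
GoodCode code = RigidChoice (lookup code) choice₁ ⊎ RigidChoice (lookup code) choice₂

goodCode? : ∀ code → Dec (GoodCode code)
goodCode? code = rigid? _ _ ⊎-dec rigid? _ _

everyCodeGood : ∀ code → GoodCode code
everyCodeGood (zero ∷ code) =
  toWitness {a? = ∀-table? 2 λ c → goodCode? (zero ∷ c)} _ code
everyCodeGood (suc zero ∷ code) =
  toWitness {a? = ∀-table? 2 λ c → goodCode? (suc zero ∷ c)} _ code
everyCodeGood (suc (suc zero) ∷ code) =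
  toWitness {a? = ∀-table? 2 λ c → goodCode? (suc (suc zero) ∷ c)} _ code
everyCodeGood (suc (suc (suc zero)) ∷ code) =
  toWitness {a? = ∀-table? 2 λ c → goodCode? (suc (suc (suc zero)) ∷ c)} _ code

module LocalAnalysis {n} (T : Graph n) (g : Fin n → Fin n)
  (φ : Fin 3 → Fin n) (φ-inj : IsInjective φ) (φ-adj : ∀ i j → T (φ i) (φ j) ≡ pathGraph 3 i j) where

  open Positions φ φ-inj

  F : Graph (n + n)
  F = functigraph T g

  code : Vec (Fin 4) 3
  code = tabulate (position ∘ g ∘ φ)

  embed : Position → Fin (n + n)
  embed = join n n ∘ Sum.map φ φ

  embed-injective : IsInjective embed
  embed-injective x y eq = onPath x y
    (trans (sym (splitAt-join n n (Sum.map φ φ x))) (trans (cong (splitAt n) eq) (splitAt-join n n (Sum.map φ φ y))))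
    where
    onPath : ∀ x y → Sum.map φ φ x ≡ Sum.map φ φ y → x ≡ y
    onPath (inj₁ i) (inj₁ j) eq = cong inj₁ (φ-inj i j (Sum.inj₁-injective eq))
    onPath (inj₂ i) (inj₂ j) eq = cong inj₂ (φ-inj i j (Sum.inj₂-injective eq))
    onPath (inj₁ i) (inj₂ j) ()
    onPath (inj₂ i) (inj₁ j) ()

  embed-adj : ∀ x y → F (embed x) (embed y) ≡ localGraph (lookup code) x y
  embed-adj (inj₁ i) (inj₁ j) rewrite splitAt-↑ˡ n (φ i) n | splitAt-↑ˡ n (φ j) n = φ-adj i j
  embed-adj (inj₂ i) (inj₂ j) rewrite splitAt-↑ʳ n n (φ i) | splitAt-↑ʳ n n (φ j) = φ-adj i j
  embed-adj (inj₁ i) (inj₂ j)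
    rewrite splitAt-↑ˡ n (φ i) n | splitAt-↑ʳ n n (φ j) | lookup∘tabulate (position ∘ g ∘ φ) i
    = does-⇔ (position-spec (g (φ i)) j) (g (φ i) ≟ φ j) (position (g (φ i)) ≟ inject₁ j)
  embed-adj (inj₂ i) (inj₁ j)
    rewrite splitAt-↑ʳ n n (φ i) | splitAt-↑ˡ n (φ j) n | lookup∘tabulate (position ∘ g ∘ φ) j
    = does-⇔ (position-spec (g (φ j)) i) (g (φ j) ≟ φ i) (position (g (φ j)) ≟ inject₁ i)

  fixingSetFromChoice : ∀ ch → WellFormed ch → RigidChoice (lookup code) ch →
    ∃[ S ] (IsFixingSet F S × 4 + ∣ S ∣ ≤ n + n)
  fixingSetFromChoice ch (free-inj , anchor∉free) rigid =
    Anchored.smallFixingSet F (embed ∘ x) (embed ∘ a)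
      (λ i j eq → free-inj i j (embed-injective (x i) (x j) eq))
      (λ f i eq → anchor∉free f i (embed-injective (a f) (x i) eq))
      (λ i j → localGraph (lookup code) (x i) (x j)) (λ i f → localGraph (lookup code) (x i) (a f))
      (λ i j → embed-adj (x i) (x j)) (λ i f → embed-adj (x i) (a f)) rigid
    where
    x : Fin 4 → Position
    x = lookup (free ch)
    a : Fin 2 → Position
    a = lookup (anchor ch)

  fixingSet : ∃[ S ] (IsFixingSet F S × 4 + ∣ S ∣ ≤ n + n)
  fixingSet = Sum.[ fixingSetFromChoice choice₁ (proj₁ choices-wellFormed)
                  , fixingSetFromChoice choice₂ (proj₂ choices-wellFormed) ]′ (everyCodeGood code)

largeTree-fixingSet : ∀ {m} (T : Graph (3 + m)) → IsTree T → (g : Fin (3 + m) → Fin (3 + m)) →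
  ∃[ S ] (IsFixingSet (functigraph T g) S × 4 + ∣ S ∣ ≤ (3 + m) + (3 + m))
largeTree-fixingSet T tree g with TreeFacts.inducedP₃ T tree {# 0} {# 1} {# 2} (λ ()) (λ ()) (λ ())
... | φ , φ-inj , φ-adj = LocalAnalysis.fixingSet T g φ φ-inj φ-adj

AnchoredConfiguration : ∀ {N r s} → Graph N → Vec (Fin N) r → Vec (Fin N) s → Set
AnchoredConfiguration G e k = IsInjective (lookup e) × (∀ f i → lookup k f ≢ lookup e i)
  × Rigid (λ i j → G (lookup e i) (lookup e j)) (λ i f → G (lookup e i) (lookup k f))

anchoredConfiguration? : ∀ {N r s} (G : Graph N) e k → Dec (AnchoredConfiguration {N} {r} {s} G e k)
anchoredConfiguration? G e k = injective? _≟_ (lookup e)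
  ×-dec (all? λ f → all? λ i → ¬? (lookup k f ≟ lookup e i))
  ×-dec rigid? _ _

configuredFixingSet : ∀ {N r s} (G : Graph N) e k → {True (anchoredConfiguration? {N} {r} {s} G e k)} →
  ∃[ S ] (IsFixingSet G S × r + ∣ S ∣ ≤ N)
configuredFixingSet G e k {checked} with toWitness checked
... | e-inj , k∉e , rigid =
  Anchored.smallFixingSet G (lookup e) (lookup k) e-inj k∉e _ _ (λ _ _ → refl) (λ _ _ → refl) rigid

-- The functigraph of P₂ for the map 0 ↦ a, 1 ↦ b.  Its vertices 0, 1 form the first copy
-- of P₂ and 2, 3 the second.
functigraphP₂ : Fin 2 → Fin 2 → Graph 4
functigraphP₂ a b = functigraph (pathGraph 2) (lookup (a ∷ b ∷ []))

2≤3 : 2 ≤ 3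
2≤3 = s≤s (s≤s z≤n)

fixedByTranspositions : ∀ {N} (G : Graph N) → {True (all? (fixedByTransposition? G))} → ∀ x → FixedNontrivially G x
fixedByTranspositions G {checked} x = fixedByTransposition⇒nontrivially G x (toWitness checked x)

-- If g is constant, F is a triangle with a pendant vertex and fix(F) = 1 = 4 - 3; otherwise
-- F is a 4-cycle and fix(F) = 2 = 4 - 2.
functigraphP₂-fix : ∀ a b → IsSymmetric (functigraphP₂ a b) →
  ∃[ t ] (2 ≤ t × t ≤ 3 × IsFixNumber (functigraphP₂ a b) (4 ∸ t))
functigraphP₂-fix zero zero symG = 3 , 2≤3 , ≤-refl ,
  fixNumber-intro (configuredFixingSet (functigraphP₂ zero zero) (# 1 ∷ # 2 ∷ # 3 ∷ []) (# 0 ∷ []))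
                  (symmetric⇒fixingSet-nonempty symG)
functigraphP₂-fix (suc zero) (suc zero) symG = 3 , 2≤3 , ≤-refl ,
  fixNumber-intro (configuredFixingSet (functigraphP₂ (suc zero) (suc zero)) (# 1 ∷ # 2 ∷ # 3 ∷ []) (# 0 ∷ []))
                  (symmetric⇒fixingSet-nonempty symG)
functigraphP₂-fix zero (suc zero) _ = 2 , ≤-refl , 2≤3 ,
  fixNumber-intro (configuredFixingSet (functigraphP₂ zero (suc zero)) (# 2 ∷ # 3 ∷ []) (# 0 ∷ # 1 ∷ []))
                  (fixingSet-two _ (fixedByTranspositions (functigraphP₂ zero (suc zero))))
functigraphP₂-fix (suc zero) zero _ = 2 , ≤-refl , 2≤3 ,
  fixNumber-intro (configuredFixingSet (functigraphP₂ (suc zero) zero) (# 2 ∷ # 3 ∷ []) (# 0 ∷ # 1 ∷ []))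
                  (fixingSet-two _ (fixedByTranspositions (functigraphP₂ (suc zero) zero)))

twoVertexTree-fix : (T : Graph 2) → IsTree T → (g : Fin 2 → Fin 2) → IsSymmetric (functigraph T g) →
  ∃[ t ] (2 ≤ t × t ≤ 3 × IsFixNumber (functigraph T g) (2 * 2 ∸ t))
twoVertexTree-fix T tree g symF =
  transfer (functigraphP₂-fix (g zero) (g (suc zero)) (symmetric-transfer F≗P₂ symF))
  where
  g≗ : ∀ u → g u ≡ lookup (g zero ∷ g (suc zero) ∷ []) u
  g≗ zero       = refl
  g≗ (suc zero) = refl
  F≗P₂ : ∀ x y → functigraph T g x y ≡ functigraphP₂ (g zero) (g (suc zero)) x y
  F≗P₂ = functigraph-cong (twoVertexTree-isPath T tree) g≗
  transfer : ∃[ t ] (2 ≤ t × t ≤ 3 × IsFixNumber (functigraphP₂ (g zero) (g (suc zero))) (4 ∸ t)) →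
             ∃[ t ] (2 ≤ t × t ≤ 3 × IsFixNumber (functigraph T g) (2 * 2 ∸ t))
  transfer (t , 2≤t , t≤3 , fixP₂) = t , 2≤t , t≤3 , fixNumber-transfer (λ x y → sym (F≗P₂ x y)) fixP₂

fixingSet-too-small : ∀ n a t → t ≤ 3 → 4 + a ≤ n + n → ¬ (2 * n ∸ t ≤ a)
fixingSet-too-small n a t t≤3 size fix≤a =
  n≮n a (≤-trans (∸-monoˡ-≤ 3 size′) (≤-trans (∸-monoʳ-≤ (2 * n) t≤3) fix≤a))
  where
  size′ : 4 + a ≤ 2 * n
  size′ = subst (4 + a ≤_) (cong (n +_) (sym (+-identityʳ n))) size

largeTree-fix : ∀ {m} (T : Graph (3 + m)) → IsTree T → (g : Fin (3 + m) → Fin (3 + m)) →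
  ∀ t → t ≤ 3 → ¬ IsFixNumber (functigraph T g) (2 * (3 + m) ∸ t)
largeTree-fix {m} T tree g t t≤3 (_ , minimal) = tooSmall (largeTree-fixingSet T tree g)
  where
  tooSmall : ∃[ S ] (IsFixingSet (functigraph T g) S × 4 + ∣ S ∣ ≤ (3 + m) + (3 + m)) → ⊥
  tooSmall (S , fixing , size) = fixingSet-too-small (3 + m) ∣ S ∣ t t≤3 size (minimal S fixing)

mainTheorem17 : ∀ {n : ℕ} (T : Graph n) → IsTree T → IsSymmetric T →
    (g : Fin n → Fin n) → IsSymmetric (functigraph T g) →
    (∃[ t ] (2 ≤ t × t ≤ 3 × IsFixNumber (functigraph T g) (2 * n ∸ t)))
      ⇔ IsIsomorphic T (pathGraph 2)
mainTheorem17 {zero} T (() , _) _ _ _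
mainTheorem17 {suc zero} T _ symT _ _ = ⊥-elim (singleVertex-asymmetric T symT)
mainTheorem17 {suc (suc zero)} T tree _ g symF =
  mk⇔ (λ _ → Permutation.id , λ u v → sym (twoVertexTree-isPath T tree u v))
      (λ _ → twoVertexTree-fix T tree g symF)
mainTheorem17 {suc (suc (suc m))} T tree _ g _ =
  mk⇔ (λ { (t , _ , t≤3 , fixF) → ⊥-elim (largeTree-fix T tree g t t≤3 fixF) })
      (λ { (φ , _) → ⊥-elim (3+m≢2 (↔⇒≡ φ)) })
  where
  3+m≢2 : 3 + m ≢ 2
  3+m≢2 ()
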